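{- Let $n \geq 1$ be an integer. If $\varphi$ is an edge precoloring of three edges of $C_{2n+1} \square K_2$ using colors from $\{1,2,3,4\}$, then $\varphi$ can be extended to a proper $4$-edge coloring of $C_{2n+1} \square K_2$.
   Context: $C_m$ is the cycle on $m$ vertices and $G \square H$ the cartesian product. An edge precoloring is a proper edge coloring of some subset of the edges; it is extended by a proper $t$-edge coloring $f$ (colors $\{1,\dots,t\}$) if $f$ agrees with it on all precolored edges. -}

module Defs where

open import Level using (Level; _⊔_; suc)
open import Data.Nat using (ℕ; _+_; _*_; _%_; NonZero)
open import Data.Fin using (Fin; toℕ)
open import Data.Product using (Σ; _×_; _,_; proj₁; proj₂)
open import Data.Sum using (_⊎_)
open import Relation.Binary.PropositionalEquality using (_≡_; _≢_)
open import Relation.Nullary using (¬_)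

-- A simple graph given by a vertex type and an adjacency relation
-- (symmetry and irreflexivity are properties of the concrete graphs below).
record Graph : Set₁ where
  field
    V   : Set
    Adj : V → V → Set
open Graph public

-- An edge is an adjacent pair of vertices; (u,v) and (v,u) denote the same edge.
Edge : Graph → Set
Edge G = Σ (V G × V G) λ p → Adj G (proj₁ p) (proj₂ p)

src tgt : {G : Graph} → Edge G → V G
src ((u , _) , _) = u
tgt ((_ , v) , _) = v

SameEdge : {G : Graph} → Edge G → Edge G → Set
SameEdge e e' = (src e ≡ src e' × tgt e ≡ tgt e') ⊎ (src e ≡ tgt e' × tgt e ≡ src e')

AdjacentEdges : {G : Graph} → Edge G → Edge G → Set
AdjacentEdges e e' =
  ¬ SameEdge e e' ×
  ((src e ≡ src e') ⊎ (src e ≡ tgt e') ⊎ (tgt e ≡ src e') ⊎ (tgt e ≡ tgt e'))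

-- A t-edge coloring (colors Fin t, i.e. {1,…,t}) which is well defined on edges
record EdgeColoring (G : Graph) (t : ℕ) : Set where
  field
    col       : Edge G → Fin t
    wellDef   : ∀ e e' → SameEdge e e' → col e ≡ col e'
open EdgeColoring public

IsProper : {G : Graph} {t : ℕ} → EdgeColoring G t → Set
IsProper {G} f = ∀ (e e' : Edge G) → AdjacentEdges e e' → col f e ≢ col f e'

-- Cycle C_m on vertex set ℤ/m (for m ≥ 3): i ~ j iff j = i+1 mod m or i = j+1 mod m
Cycle : (m : ℕ) → .{{NonZero m}} → Graph
Cycle m = record
  { V = Fin m
  ; Adj = λ i j → (toℕ j ≡ (toℕ i + 1) % m) ⊎ (toℕ i ≡ (toℕ j + 1) % m) }

K2 : Graph
K2 = record { V = Fin 2 ; Adj = λ i j → i ≢ j }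

_□_ : Graph → Graph → Graph
G □ H = record
  { V = V G × V H
  ; Adj = λ p q → (proj₁ p ≡ proj₁ q × Adj H (proj₂ p) (proj₂ q))
                ⊎ (Adj G (proj₁ p) (proj₁ q) × proj₂ p ≡ proj₂ q) }

record Precoloring3 (G : Graph) (t : ℕ) : Set where
  field
    e₁ e₂ e₃ : Edge G
    c₁ c₂ c₃ : Fin t
    dist₁₂ : ¬ SameEdge e₁ e₂
    dist₁₃ : ¬ SameEdge e₁ e₃
    dist₂₃ : ¬ SameEdge e₂ e₃
    prop₁₂ : AdjacentEdges e₁ e₂ → c₁ ≢ c₂
    prop₁₃ : AdjacentEdges e₁ e₃ → c₁ ≢ c₃
    prop₂₃ : AdjacentEdges e₂ e₃ → c₂ ≢ c₃
open Precoloring3 public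

Extends : {G : Graph} {t : ℕ} → EdgeColoring G t → Precoloring3 G t → Set
Extends f φ = col f (e₁ φ) ≡ c₁ φ × col f (e₂ φ) ≡ c₂ φ × col f (e₃ φ) ≡ c₃ φ

module Submission where

open import Defs
open import Data.Nat using (ℕ; suc; _*_; _≥_)
open import Data.Product using (Σ; _×_)

open import Data.Bool.Base using (Bool; true; T; _∧_; if_then_else_)
open import Data.Bool.Properties using (T-≡; T-∧)
open import Data.Empty using (⊥; ⊥-elim)
open import Data.Fin.Base using (Fin; zero; suc; toℕ)
open import Data.Fin.Patterns using (0F; 1F; 2F)
open import Data.Fin.Properties using (_≟_; any?; all?; toℕ-fromℕ<; toℕ-injective; toℕ<n; suc-injective)
open import Data.List.Base using (List; []; _∷_; length)
open import Data.List.Membership.Propositional using (_∈_)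
open import Data.List.Relation.Unary.All as All using ([]; _∷_)
open import Data.List.Relation.Unary.AllPairs using (AllPairs; []; _∷_)
open import Data.List.Relation.Unary.Any using (here; there)
open import Data.Maybe.Base using (Maybe; just; nothing)
open import Data.Maybe.Properties using (just-injective)
open import Data.Maybe.Relation.Unary.All using (just; nothing) renaming (All to AllJust)
open import Data.Nat.Base using (zero; _+_; _∸_; _≤_; _<_; z≤n; s≤s; s≤s⁻¹; NonZero; >-nonZero⁻¹)
open import Data.Nat.DivMod using (_%_; _mod_; m%n<n; [m+n]%n≡m%n; m<n⇒m%n≡m; %-distribˡ-+; m%n%n≡m%n; n%n≡0)
open import Data.Nat.Properties
  using ( +-0-commutativeMonoid; +-assoc; +-comm; +-identityʳ; +-suc; +-monoʳ-≤; +-mono-≤; *-monoʳ-≤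
        ; ≤-refl; ≤-reflexive; ≤-trans; <-trans; <-≤-trans; <⇒≤; <⇒≢; <-irrefl; ≤∧≢⇒<; n≢0⇒n>0; 0≢1+n
        ; m≤n+m; m≤m+n; m∸n+n≡m; m+[n∸m]≡n; m≤n⇒∃[o]m+o≡n; module ≤-Reasoning )
  renaming (_≟_ to _≟ℕ_)
open import Algebra.Properties.CommutativeMonoid.Sum +-0-commutativeMonoid
  using (sum-syntax; ∑-distrib-+; sum-cong-≗; sum-replicate-zero)
open import Data.Product.Base using (∃; ∃-syntax; Σ-syntax; _,_; proj₁; proj₂)
open import Data.Sum.Base using (_⊎_; inj₁; inj₂)
open import Data.Unit.Base using (⊤; tt)
open import Function.Base using (_∘_; id)
open import Function.Bundles using (Equivalence)
open import Function.Definitions using (Injective)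
open import Relation.Binary.PropositionalEquality
  using (_≡_; _≢_; refl; sym; trans; subst; subst₂; cong; cong₂; module ≡-Reasoning)
open import Relation.Nullary.Decidable
  using (Dec; yes; no; does; isYes; dec-false; map′; ¬?; _×-dec_; _→-dec_; toWitness)
open import Relation.Nullary.Negation using (¬_)

-- A 4-edge-colouring of C_m □ K₂ is a cyclic sequence of column states: the
-- colours of the rung at column i and of the two rail edges from i to i + 1. It is
-- proper iff every state is valid and consecutive states are compatible, and the three
-- precoloured edges prescribe at most three entries of this sequence. An exhaustive
-- search over the 64 states shows that (1) any two valid states are joined through a
-- third one, and (2) three consecutive columns carrying at most three prescribed
-- entries can always be filled. If some column carries no prescribed entry, read the
-- cycle starting just after it: fill each run of constrained columns by (2), cross the
-- gaps between runs by (1), and close the cycle at the free column, again by (1).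
-- Otherwise m = 3 with one entry per column, which is settled by a third search.

∑-mono-≤ : ∀ {K} {g h : Fin K → ℕ} → (∀ o → g o ≤ h o) → ∑[ o < K ] g o ≤ ∑[ o < K ] h o
∑-mono-≤ {zero} _ = z≤n
∑-mono-≤ {suc K} g≤h = +-mono-≤ (g≤h zero) (∑-mono-≤ (g≤h ∘ suc))

∑-nonzero-≥ : ∀ {K} {g : Fin K → ℕ} → (∀ o → g o ≢ 0) → K ≤ ∑[ o < K ] g o
∑-nonzero-≥ {zero} _ = z≤n
∑-nonzero-≥ {suc K} g≢0 = +-mono-≤ (n≢0⇒n>0 (g≢0 zero)) (∑-nonzero-≥ (g≢0 ∘ suc))

∑-indicator-injective : ∀ {K n} (f : Fin K → Fin n) → Injective _≡_ _≡_ f →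
                        ∀ i → ∑[ o < K ] (if does (i ≟ f o) then 1 else 0) ≤ 1
∑-indicator-injective {zero} f inj i = z≤n
∑-indicator-injective {suc K} f inj i = first (i ≟ f zero)
  where
  first : (d : Dec (i ≡ f zero)) →
          (if does d then 1 else 0) + ∑[ o < K ] (if does (i ≟ f (suc o)) then 1 else 0) ≤ 1
  first (yes refl) = ≤-reflexive (cong suc (trans (sum-cong-≗ missed) (sum-replicate-zero K)))
    where
    missed : ∀ o → (if does (f zero ≟ f (suc o)) then 1 else 0) ≡ 0
    missed o = cong (if_then 1 else 0) (dec-false (f zero ≟ f (suc o)) (λ eq → 0≢1+n (cong toℕ (inj eq))))
  first (no _) = ∑-indicator-injective (f ∘ suc) (suc-injective ∘ inj) i

allPairs-related : ∀ {A : Set} {R : A → A → Set} {xs x y} → AllPairs R xs → x ∈ xs → y ∈ xs →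
                   x ≡ y ⊎ R x y ⊎ R y x
allPairs-related (_ ∷ _) (here refl) (here refl) = inj₁ refl
allPairs-related (rs ∷ _) (here refl) (there y∈) = inj₂ (inj₁ (All.lookup rs y∈))
allPairs-related (rs ∷ _) (there x∈) (here refl) = inj₂ (inj₂ (All.lookup rs x∈))
allPairs-related (_ ∷ rss) (there x∈) (there y∈) = allPairs-related rss x∈ y∈

-- Column states and patterns

Colour : Set
Colour = Fin 4

data Component : Set where
  rung : Component
  rail : Fin 2 → Component

record Column (X : Set) : Set where
  constructor column
  field
    onRung onRail₀ onRail₁ : X

infixl 30 _at_
_at_ : {X : Set} → Column X → Component → X
c at rung = Column.onRung c
c at rail zero = Column.onRail₀ c
c at rail (suc zero) = Column.onRail₁ c

State : Set
State = Column Colour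

-- the entries prescribed by a precolouring
Pattern : Set
Pattern = Column (Maybe Colour)

module _ {X : Set} (_#_ : X → X → Set) where

  ValidBy : Column X → Set
  ValidBy s = ∀ b → s at rail b # s at rung

  PrecedesBy : Column X → Column X → Set
  PrecedesBy s t = ∀ b → s at rail b # t at rung × s at rail b # t at rail b

Valid : State → Set
Valid = ValidBy _≢_

infix 4 _⟶_ _⇢_
_⟶_ : State → State → Set
_⟶_ = PrecedesBy _≢_

Apart : Maybe Colour → Maybe Colour → Set
Apart (just a) (just b) = a ≢ b
Apart _ _ = ⊤

Consistent : Pattern → Set
Consistent = ValidBy Apart

_⇢_ : Pattern → Pattern → Set
_⇢_ = PrecedesBy Apart

Matches : Pattern → State → Set
Matches B s = ∀ q → AllJust (_≡ s at q) (B at q)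

Fits : Pattern → State → Set
Fits B s = Matches B s × Valid s

cost : Maybe Colour → ℕ
cost nothing = 0
cost (just _) = 1

size : Pattern → ℕ
size B = cost (B at rung) + (cost (B at rail zero) + cost (B at rail (suc zero)))

size≡0⇒matches : ∀ {B} s → size B ≡ 0 → Matches B s
size≡0⇒matches {column nothing nothing nothing} s _ rung = nothing
size≡0⇒matches {column nothing nothing nothing} s _ (rail zero) = nothing
size≡0⇒matches {column nothing nothing nothing} s _ (rail (suc zero)) = nothing

blank : Pattern
blank = column nothing nothing nothing

blank-at : ∀ q → blank at q ≡ nothing
blank-at rung = refl
blank-at (rail zero) = refl
blank-at (rail (suc zero)) = refl

_[_]≔_ : {X : Set} → Column X → Component → X → Column X
c [ rung ]≔ x = record c { onRung = x }
c [ rail zero ]≔ x = record c { onRail₀ = x }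
c [ rail (suc zero) ]≔ x = record c { onRail₁ = x }

at∘≔ : ∀ {X} (c : Column X) q x → (c [ q ]≔ x) at q ≡ x
at∘≔ c rung x = refl
at∘≔ c (rail zero) x = refl
at∘≔ c (rail (suc zero)) x = refl

at∘≔′ : ∀ {X} (c : Column X) {q q′} x → q′ ≢ q → (c [ q′ ]≔ x) at q ≡ c at q
at∘≔′ c {rung} {rung} x q′≢q = ⊥-elim (q′≢q refl)
at∘≔′ c {rung} {rail zero} x _ = refl
at∘≔′ c {rung} {rail (suc zero)} x _ = refl
at∘≔′ c {rail zero} {rung} x _ = refl
at∘≔′ c {rail zero} {rail zero} x q′≢q = ⊥-elim (q′≢q refl)
at∘≔′ c {rail zero} {rail (suc zero)} x _ = refl
at∘≔′ c {rail (suc zero)} {rung} x _ = refl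
at∘≔′ c {rail (suc zero)} {rail zero} x _ = refl
at∘≔′ c {rail (suc zero)} {rail (suc zero)} x q′≢q = ⊥-elim (q′≢q refl)

size∘≔ : ∀ B q c → size (B [ q ]≔ just c) ≤ suc (size B)
size∘≔ (column x y z) rung c = s≤s (m≤n+m _ (cost x))
size∘≔ (column x y z) (rail zero) c = begin
  cost x + suc (cost z)            ≡⟨ +-suc (cost x) (cost z) ⟩
  suc (cost x + cost z)            ≤⟨ s≤s (+-monoʳ-≤ (cost x) (m≤n+m (cost z) (cost y))) ⟩
  suc (cost x + (cost y + cost z)) ∎
  where open ≤-Reasoning
size∘≔ (column x y z) (rail (suc zero)) c = begin
  cost x + (cost y + 1)            ≡⟨ cong (cost x +_) (+-comm (cost y) 1) ⟩
  cost x + suc (cost y)            ≡⟨ +-suc (cost x) (cost y) ⟩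
  suc (cost x + cost y)            ≤⟨ s≤s (+-monoʳ-≤ (cost x) (m≤m+n (cost y) (cost z))) ⟩
  suc (cost x + (cost y + cost z)) ∎
  where open ≤-Reasoning

_≟ᶜ_ : (q q′ : Component) → Dec (q ≡ q′)
rung ≟ᶜ rung = yes refl
rung ≟ᶜ rail _ = no λ ()
rail _ ≟ᶜ rung = no λ ()
rail b ≟ᶜ rail b′ = map′ (cong rail) (λ { refl → refl }) (b ≟ b′)

-- Exhaustive checks

module _ {X : Set} {_#_ : X → X → Set} (_#?_ : ∀ x y → Dec (x # y)) where

  validBy? : ∀ s → Dec (ValidBy _#_ s)
  validBy? s = all? λ b → s at rail b #? s at rung

  precedesBy? : ∀ s t → Dec (PrecedesBy _#_ s t)
  precedesBy? s t = all? λ b → (s at rail b #? t at rung) ×-dec (s at rail b #? t at rail b)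

_≢?_ : (a b : Colour) → Dec (a ≢ b)
a ≢? b = ¬? (a ≟ b)

apart? : ∀ x y → Dec (Apart x y)
apart? (just a) (just b) = a ≢? b
apart? (just _) nothing = yes tt
apart? nothing _ = yes tt

valid? : ∀ s → Dec (Valid s)
valid? = validBy? _≢?_

_⟶?_ : ∀ s t → Dec (s ⟶ t)
_⟶?_ = precedesBy? _≢?_

consistent? : ∀ B → Dec (Consistent B)
consistent? = validBy? apart?

_⇢?_ : ∀ B C → Dec (B ⇢ C)
_⇢?_ = precedesBy? apart?

∃-state? : {P : State → Set} → (∀ s → Dec (P s)) → Dec (∃ P)
∃-state? P? = map′ (λ (r , a , b , p) → column r a b , p) (λ (column r a b , p) → r , a , b , p)
  (any? λ r → any? λ a → any? λ b → P? (column r a b))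

∀-state? : {P : State → Set} → (∀ s → Dec (P s)) → Dec (∀ s → P s)
∀-state? P? = map′ (λ p (column r a b) → p r a b) (λ p r a b → p (column r a b))
  (all? λ r → all? λ a → all? λ b → P? (column r a b))

∃-agreeing? : ∀ x {P : Colour → Set} → (∀ c → Dec (P c)) → Dec (∃[ c ] AllJust (_≡ c) x × P c)
∃-agreeing? nothing P? = map′ (λ (c , p) → c , nothing , p) (λ (c , _ , p) → c , p) (any? P?)
∃-agreeing? (just a) P? = map′ (λ p → a , just refl , p) (λ { (_ , just refl , p) → p }) (P? a)

∃-fitting? : ∀ B {P : State → Set} → (∀ s → Dec (P s)) → Dec (∃[ s ] Fits B s × P s)
∃-fitting? B P? = map′
  (λ (r , mr , a , ma , b , mb , v , p) → column r a b , (matches mr ma mb , v) , p)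
  (λ (column r a b , (m , v) , p) → r , m rung , a , m (rail zero) , b , m (rail (suc zero)) , v , p)
  (∃-agreeing? (B at rung) λ r → ∃-agreeing? (B at rail zero) λ a → ∃-agreeing? (B at rail (suc zero)) λ b →
     valid? (column r a b) ×-dec P? (column r a b))
  where
  matches : ∀ {r a b} → AllJust (_≡ r) (B at rung) → AllJust (_≡ a) (B at rail zero) →
            AllJust (_≡ b) (B at rail (suc zero)) → Matches B (column r a b)
  matches mr ma mb rung = mr
  matches mr ma mb (rail zero) = ma
  matches mr ma mb (rail (suc zero)) = mb

∧-split : ∀ x y → T (x ∧ y) → T x × T y
∧-split x y = Equivalence.to (T-∧ {x} {y})

allColours : (Colour → Bool) → Bool
allColours p = p zero ∧ (p (suc zero) ∧ (p (suc (suc zero)) ∧ p (suc (suc (suc zero)))))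

allColours-sound : ∀ p → T (allColours p) → ∀ c → T (p c)
allColours-sound p h zero = proj₁ (∧-split _ _ h)
allColours-sound p h (suc zero) = proj₁ (∧-split _ _ (proj₂ (∧-split (p zero) _ h)))
allColours-sound p h (suc (suc zero)) =
  proj₁ (∧-split _ _ (proj₂ (∧-split (p (suc zero)) _ (proj₂ (∧-split (p zero) _ h)))))
allColours-sound p h (suc (suc (suc zero))) =
  proj₂ (∧-split (p (suc (suc zero))) _ (proj₂ (∧-split (p (suc zero)) _ (proj₂ (∧-split (p zero) _ h)))))

-- The continuation receives each entry of cost at most b together with the unused budget.
allEntries : ℕ → (Maybe Colour → ℕ → Bool) → Bool
allEntries zero k = k nothing zero
allEntries (suc b) k = k nothing (suc b) ∧ allColours λ c → k (just c) b

allEntries-sound : ∀ b k → T (allEntries b k) → ∀ x r → cost x + r ≡ b → T (k x r)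
allEntries-sound zero k h nothing r refl = h
allEntries-sound (suc b) k h nothing r refl = proj₁ (∧-split (k nothing (suc b)) _ h)
allEntries-sound (suc b) k h (just c) r refl =
  allColours-sound (λ c → k (just c) b) (proj₂ (∧-split (k nothing (suc b)) _ h)) c

allPatterns : ℕ → (Pattern → ℕ → Bool) → Bool
allPatterns b k = allEntries b λ x b₁ → allEntries b₁ λ y b₂ → allEntries b₂ λ z → k (column x y z)

+-reassoc : ∀ a b c d → (a + (b + c)) + d ≡ a + (b + (c + d))
+-reassoc a b c d = trans (+-assoc a (b + c) d) (cong (a +_) (+-assoc b c d))

allPatterns-sound : ∀ b k → T (allPatterns b k) → ∀ B r → size B + r ≡ b → T (k B r)
allPatterns-sound b k h (column x y z) r eq =
  allEntries-sound (cost z + r) (λ z → k (column x y z))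
    (allEntries-sound (cost y + (cost z + r)) (λ y b₂ → allEntries b₂ λ z → k (column x y z))
      (allEntries-sound b (λ x b₁ → allEntries b₁ λ y b₂ → allEntries b₂ λ z → k (column x y z)) h
        x (cost y + (cost z + r)) eq′)
      y (cost z + r) refl)
    z r refl
  where
  eq′ : cost x + (cost y + (cost z + r)) ≡ b
  eq′ = trans (sym (+-reassoc (cost x) (cost y) (cost z) r)) eq

allTriples : (Pattern → Pattern → Pattern → Bool) → Bool
allTriples k = allPatterns 3 λ B₀ b₀ → allPatterns b₀ λ B₁ b₁ → allPatterns b₁ λ B₂ _ → k B₀ B₁ B₂

-- The continuations are spelled out: leaving them to unification, or abstracting with
-- `with`, would unfold the whole enumeration.
allTriples-sound : ∀ k → allTriples k ≡ true →
                   ∀ B₀ B₁ B₂ → size B₀ + (size B₁ + size B₂) ≤ 3 → T (k B₀ B₁ B₂)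
allTriples-sound k h B₀ B₁ B₂ budget =
  allPatterns-sound (size B₂ + slack) (λ B₂ _ → k B₀ B₁ B₂)
    (allPatterns-sound (size B₁ + (size B₂ + slack)) (λ B₁ b₁ → allPatterns b₁ λ B₂ _ → k B₀ B₁ B₂)
      (allPatterns-sound 3 (λ B₀ b₀ → allPatterns b₀ λ B₁ b₁ → allPatterns b₁ λ B₂ _ → k B₀ B₁ B₂)
        (Equivalence.from (T-≡ {allTriples k}) h) B₀ (size B₁ + (size B₂ + slack)) eq)
      B₁ (size B₂ + slack) refl)
    B₂ slack refl
  where
  slack : ℕ
  slack = proj₁ (m≤n⇒∃[o]m+o≡n budget)
  eq : size B₀ + (size B₁ + (size B₂ + slack)) ≡ 3
  eq = trans (sym (+-reassoc (size B₀) (size B₁) (size B₂) slack)) (proj₂ (m≤n⇒∃[o]m+o≡n budget))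

isYes≡true⇒ : {P : Set} (d : Dec P) → isYes d ≡ true → P
isYes≡true⇒ (yes p) _ = p

Bridge : State → State → Set
Bridge s u = ∃[ t ] Valid t × s ⟶ t × t ⟶ u

bridge? : Dec (∀ s u → Valid s → Valid u → Bridge s u)
bridge? = ∀-state? λ s → ∀-state? λ u → valid? s →-dec valid? u →-dec
  ∃-state? λ t → valid? t ×-dec s ⟶? t ×-dec t ⟶? u

Fill₃ : Pattern → Pattern → Pattern → Set
Fill₃ B₀ B₁ B₂ = ∃[ t₀ ] Fits B₀ t₀ × ∃[ t₁ ] Fits B₁ t₁ × t₀ ⟶ t₁ × ∃[ t₂ ] Fits B₂ t₂ × t₁ ⟶ t₂

fill₃? : ∀ B₀ B₁ B₂ →
         Dec (Consistent B₀ → Consistent B₁ → Consistent B₂ → B₀ ⇢ B₁ → B₁ ⇢ B₂ → Fill₃ B₀ B₁ B₂)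
fill₃? B₀ B₁ B₂ = consistent? B₀ →-dec consistent? B₁ →-dec consistent? B₂ →-dec
  B₀ ⇢? B₁ →-dec B₁ ⇢? B₂ →-dec
  ∃-fitting? B₀ λ t₀ → ∃-fitting? B₁ λ t₁ → t₀ ⟶? t₁ ×-dec ∃-fitting? B₂ λ t₂ → t₁ ⟶? t₂

CyclicFill₃ : Pattern → Pattern → Pattern → Set
CyclicFill₃ B₀ B₁ B₂ =
  ∃[ t₀ ] Fits B₀ t₀ × ∃[ t₂ ] Fits B₂ t₂ × t₂ ⟶ t₀ × ∃[ t₁ ] Fits B₁ t₁ × t₀ ⟶ t₁ × t₁ ⟶ t₂

cyclicFill₃? : ∀ B₀ B₁ B₂ →
  Dec (size B₀ ≢ 0 → size B₁ ≢ 0 → size B₂ ≢ 0 →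
       Consistent B₀ → Consistent B₁ → Consistent B₂ → B₀ ⇢ B₁ → B₁ ⇢ B₂ → B₂ ⇢ B₀ → CyclicFill₃ B₀ B₁ B₂)
cyclicFill₃? B₀ B₁ B₂ = ¬? (size B₀ ≟ℕ 0) →-dec ¬? (size B₁ ≟ℕ 0) →-dec ¬? (size B₂ ≟ℕ 0) →-dec
  consistent? B₀ →-dec consistent? B₁ →-dec consistent? B₂ →-dec B₀ ⇢? B₁ →-dec B₁ ⇢? B₂ →-dec B₂ ⇢? B₀ →-dec
  ∃-fitting? B₀ λ t₀ → ∃-fitting? B₂ λ t₂ → t₂ ⟶? t₀ ×-dec ∃-fitting? B₁ λ t₁ → t₀ ⟶? t₁ ×-dec t₁ ⟶? t₂

bridge-check : isYes bridge? ≡ true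
bridge-check = refl

fill₃-check : allTriples (λ B₀ B₁ B₂ → isYes (fill₃? B₀ B₁ B₂)) ≡ true
fill₃-check = refl

cyclicFill₃-check : allTriples (λ B₀ B₁ B₂ → isYes (cyclicFill₃? B₀ B₁ B₂)) ≡ true
cyclicFill₃-check = refl

-- Opaque, so that type checking never unfolds these proofs into the searches behind them.
opaque
  bridge : ∀ s u → Valid s → Valid u → Bridge s u
  bridge = isYes≡true⇒ bridge? bridge-check

  fill₃ : ∀ B₀ B₁ B₂ → size B₀ + (size B₁ + size B₂) ≤ 3 →
          Consistent B₀ → Consistent B₁ → Consistent B₂ → B₀ ⇢ B₁ → B₁ ⇢ B₂ → Fill₃ B₀ B₁ B₂
  fill₃ B₀ B₁ B₂ budget = toWitness {a? = fill₃? B₀ B₁ B₂}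
    (allTriples-sound (λ B₀ B₁ B₂ → isYes (fill₃? B₀ B₁ B₂)) fill₃-check B₀ B₁ B₂ budget)

  cyclicFill₃ : ∀ B₀ B₁ B₂ → size B₀ + (size B₁ + size B₂) ≤ 3 → size B₀ ≢ 0 → size B₁ ≢ 0 → size B₂ ≢ 0 →
                Consistent B₀ → Consistent B₁ → Consistent B₂ → B₀ ⇢ B₁ → B₁ ⇢ B₂ → B₂ ⇢ B₀ →
                CyclicFill₃ B₀ B₁ B₂
  cyclicFill₃ B₀ B₁ B₂ budget = toWitness {a? = cyclicFill₃? B₀ B₁ B₂}
    (allTriples-sound (λ B₀ B₁ B₂ → isYes (cyclicFill₃? B₀ B₁ B₂)) cyclicFill₃-check B₀ B₁ B₂ budget)

bridged : Σ State Valid → Σ State Valid → Σ State Valid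
bridged (s , vs) (u , vu) = let t , vt , _ = bridge s u vs vu in t , vt

bridged-from : ∀ p q → proj₁ p ⟶ proj₁ (bridged p q)
bridged-from (s , vs) (u , vu) = proj₁ (proj₂ (proj₂ (bridge s u vs vu)))

bridged-to : ∀ p q → proj₁ (bridged p q) ⟶ proj₁ q
bridged-to (s , vs) (u , vu) = proj₂ (proj₂ (proj₂ (bridge s u vs vu)))

-- Filling paths

someValid : Σ State Valid
someValid = column zero (suc zero) (suc zero) , λ { zero () ; (suc zero) () }

record PathFill (B : ℕ → Pattern) (s : ℕ → State) : Set where
  field
    fits  : ∀ j → Fits (B j) (s j)
    links : ∀ j → s j ⟶ s (suc j)

-- A run of constrained columns (at most three of them) is filled by fill₃ from its first
-- column on; every free column bridges its left neighbour to the start of the next run.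
module Walk (B : ℕ → Pattern)
            (consistent : ∀ j → Consistent (B j))
            (linked : ∀ j → B j ⇢ B (suc j))
            (budget : ∀ j → ∑[ o < 4 ] size (B (toℕ o + j)) ≤ 3) where

  free? : ∀ k → Dec (size (B k) ≡ 0)
  free? k = size (B k) ≟ℕ 0

  no-four-constrained : ∀ j → size (B j) ≢ 0 → size (B (1 + j)) ≢ 0 → size (B (2 + j)) ≢ 0 →
                        size (B (3 + j)) ≢ 0 → ⊥
  no-four-constrained j c₀ c₁ c₂ c₃ = <-irrefl refl (≤-trans (∑-nonzero-≥ constrained) (budget j))
    where
    constrained : ∀ (o : Fin 4) → size (B (toℕ o + j)) ≢ 0
    constrained zero = c₀
    constrained (suc zero) = c₁
    constrained (suc (suc zero)) = c₂
    constrained (suc (suc (suc zero))) = c₃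

  WindowFill : ℕ → (ℕ → State) → Set
  WindowFill j t = (∀ o → o < 3 → Fits (B (o + j)) (t o)) × (∀ o → o < 2 → t o ⟶ t (suc o))

  window : ∀ j → ∃ (WindowFill j)
  window j = from-fill₃ (fill₃ (B j) (B (1 + j)) (B (2 + j)) three-columns
    (consistent j) (consistent (1 + j)) (consistent (2 + j)) (linked j) (linked (1 + j)))
    where
    three-columns : size (B j) + (size (B (1 + j)) + size (B (2 + j))) ≤ 3
    three-columns = ≤-trans (+-monoʳ-≤ (size (B j)) (+-monoʳ-≤ (size (B (1 + j))) (m≤m+n _ _))) (budget j)
    from-fill₃ : Fill₃ (B j) (B (1 + j)) (B (2 + j)) → ∃ (WindowFill j)
    from-fill₃ (t₀ , f₀ , t₁ , f₁ , l₀ , t₂ , f₂ , l₁) = t , fits , links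
      where
      t : ℕ → State
      t 0 = t₀
      t 1 = t₁
      t _ = t₂
      fits : ∀ o → o < 3 → Fits (B (o + j)) (t o)
      fits 0 _ = f₀
      fits 1 _ = f₁
      fits 2 _ = f₂
      fits (suc (suc (suc _))) (s≤s (s≤s (s≤s ())))
      links : ∀ o → o < 2 → t o ⟶ t (suc o)
      links 0 _ = l₀
      links 1 _ = l₁
      links (suc (suc _)) (s≤s (s≤s ()))

  -- the number of constrained columns immediately to the left of column k
  offset : ℕ → ℕ
  offset zero = 0
  offset (suc k) with free? k
  ... | yes _ = 0
  ... | no _ = suc (offset k)

  offset-step : ∀ k → offset (suc k) ≡ 0 ⊎ size (B k) ≢ 0 × offset (suc k) ≡ suc (offset k)
  offset-step k with free? k
  ... | yes _ = inj₁ refl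
  ... | no c = inj₂ (c , refl)

  offset-constrained : ∀ k → size (B k) ≢ 0 → offset (suc k) ≡ suc (offset k)
  offset-constrained k c with free? k
  ... | yes f = ⊥-elim (c f)
  ... | no _ = refl

  offset≤ : ∀ k → offset k ≤ k
  offset≤ zero = z≤n
  offset≤ (suc k) with free? k
  ... | yes _ = z≤n
  ... | no _ = s≤s (offset≤ k)

  offset<3 : ∀ k → size (B k) ≢ 0 → offset k < 3
  offset<3 0 _ = s≤s z≤n
  offset<3 1 _ = s≤s (≤-trans (offset≤ 1) (s≤s z≤n))
  offset<3 2 _ = s≤s (offset≤ 2)
  offset<3 (suc (suc (suc j))) c₃ with offset-step (2 + j) | offset-step (1 + j) | offset-step j
  ... | inj₁ e₂ | _ | _ = subst (_< 3) (sym e₂) (s≤s z≤n)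
  ... | inj₂ (_ , e₂) | inj₁ e₁ | _ = subst (_< 3) (sym (trans e₂ (cong suc e₁))) (s≤s (s≤s z≤n))
  ... | inj₂ (_ , e₂) | inj₂ (_ , e₁) | inj₁ e₀ =
    subst (_< 3) (sym (trans e₂ (cong suc (trans e₁ (cong suc e₀))))) (s≤s (s≤s (s≤s z≤n)))
  ... | inj₂ (c₂ , _) | inj₂ (c₁ , _) | inj₂ (c₀ , _) = ⊥-elim (no-four-constrained j c₀ c₁ c₂ c₃)

  block : ℕ → State
  block k = proj₁ (window (k ∸ offset k)) (offset k)

  block-fits : ∀ k → size (B k) ≢ 0 → Fits (B k) (block k)
  block-fits k c = subst (λ j → Fits (B j) (block k)) (m+[n∸m]≡n (offset≤ k))
    (proj₁ (proj₂ (window (k ∸ offset k))) (offset k) (offset<3 k c))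

  block-links : ∀ k → size (B k) ≢ 0 → size (B (suc k)) ≢ 0 → block k ⟶ block (suc k)
  block-links k c c′ = subst (λ o → block k ⟶ proj₁ (window (suc k ∸ o)) o) (sym (offset-constrained k c))
    (proj₂ (proj₂ (window (k ∸ offset k))) (offset k)
      (s≤s⁻¹ (subst (_< 3) (offset-constrained k c) (offset<3 (suc k) c′))))

  target : ℕ → Σ State Valid
  target k with free? k
  ... | yes _ = someValid
  ... | no c = block k , proj₂ (block-fits k c)

  target-constrained : ∀ k → size (B k) ≢ 0 → proj₁ (target k) ≡ block k
  target-constrained k c with free? k
  ... | yes f = ⊥-elim (c f)
  ... | no _ = refl

  step : Σ State Valid → ℕ → Σ State Valid
  step p k with free? k
  ... | yes _ = bridged p (target (suc k))
  ... | no c = block k , proj₂ (block-fits k c)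

  step-free : ∀ p k → size (B k) ≡ 0 → step p k ≡ bridged p (target (suc k))
  step-free p k f with free? k
  ... | yes _ = refl
  ... | no c = ⊥-elim (c f)

  step-constrained : ∀ p k → size (B k) ≢ 0 → proj₁ (step p k) ≡ block k
  step-constrained p k c with free? k
  ... | yes f = ⊥-elim (c f)
  ... | no _ = refl

  step-fits : ∀ p k → Fits (B k) (proj₁ (step p k))
  step-fits p k = fits (free? k)
    where
    fits : Dec (size (B k) ≡ 0) → Fits (B k) (proj₁ (step p k))
    fits (yes f) = subst (Fits (B k) ∘ proj₁) (sym (step-free p k f))
      (size≡0⇒matches _ f , proj₂ (bridged p (target (suc k))))
    fits (no c) = subst (Fits (B k)) (sym (step-constrained p k c)) (block-fits k c)

  step-from : ∀ p k → size (B k) ≡ 0 → proj₁ p ⟶ proj₁ (step p k)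
  step-from p k f = subst (λ x → proj₁ p ⟶ proj₁ x) (sym (step-free p k f)) (bridged-from p (target (suc k)))

  step-to : ∀ p k → size (B k) ≡ 0 → size (B (suc k)) ≢ 0 → proj₁ (step p k) ⟶ block (suc k)
  step-to p k f c = subst₂ (λ x y → proj₁ x ⟶ y) (sym (step-free p k f)) (target-constrained (suc k) c)
    (bridged-to p (target (suc k)))

  walk : ℕ → Σ State Valid
  walk zero = step someValid zero
  walk (suc k) = step (walk k) (suc k)

  before : ℕ → Σ State Valid
  before zero = someValid
  before (suc k) = walk k

  walk-step : ∀ k → walk k ≡ step (before k) k
  walk-step zero = refl
  walk-step (suc k) = refl

  walk-links : ∀ k → proj₁ (walk k) ⟶ proj₁ (walk (suc k))
  walk-links k = link (free? (suc k)) (free? k)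
    where
    into-block : size (B (suc k)) ≢ 0 → Dec (size (B k) ≡ 0) → proj₁ (walk k) ⟶ block (suc k)
    into-block c′ (yes f) =
      subst (λ p → proj₁ p ⟶ block (suc k)) (sym (walk-step k)) (step-to (before k) k f c′)
    into-block c′ (no c) =
      subst (_⟶ block (suc k)) (sym (trans (cong proj₁ (walk-step k)) (step-constrained (before k) k c)))
        (block-links k c c′)
    link : Dec (size (B (suc k)) ≡ 0) → Dec (size (B k) ≡ 0) → proj₁ (walk k) ⟶ proj₁ (walk (suc k))
    link (yes f′) _ = step-from (walk k) (suc k) f′
    link (no c′) d = subst (proj₁ (walk k) ⟶_) (sym (step-constrained (walk k) (suc k) c′)) (into-block c′ d)

path-fill : ∀ B → (∀ j → Consistent (B j)) → (∀ j → B j ⇢ B (suc j)) →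
            (∀ j → ∑[ o < 4 ] size (B (toℕ o + j)) ≤ 3) → ∃ (PathFill B)
path-fill B consistent linked budget = proj₁ ∘ walk , record
  { fits  = λ j → subst (Fits (B j) ∘ proj₁) (sym (walk-step j)) (step-fits (before j) j)
  ; links = walk-links
  }
  where open Walk B consistent linked budget

-- Cycles

module Cyclic (m : ℕ) .{{_ : NonZero m}} where

  open ≡-Reasoning

  [a%m+b]%m≡[a+b]%m : ∀ a b → (a % m + b) % m ≡ (a + b) % m
  [a%m+b]%m≡[a+b]%m a b = begin
    (a % m + b) % m            ≡⟨ %-distribˡ-+ (a % m) b m ⟩
    (a % m % m + b % m) % m    ≡⟨ cong (λ x → (x + b % m) % m) (m%n%n≡m%n a m) ⟩
    (a % m + b % m) % m        ≡⟨ %-distribˡ-+ a b m ⟨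
    (a + b) % m                ∎

  wrap : ℕ → Fin m
  wrap j = j mod m

  toℕ-wrap : ∀ j → toℕ (wrap j) ≡ j % m
  toℕ-wrap j = toℕ-fromℕ< (m%n<n j m)

  wrap-toℕ : ∀ i → wrap (toℕ i) ≡ i
  wrap-toℕ i = toℕ-injective (trans (toℕ-wrap (toℕ i)) (m<n⇒m%n≡m (toℕ<n i)))

  shift : ℕ → Fin m → Fin m
  shift r i = wrap (toℕ i + r)

  next : Fin m → Fin m
  next = shift 1

  toℕ-shift : ∀ r i → toℕ (shift r i) ≡ (toℕ i + r) % m
  toℕ-shift r i = toℕ-wrap (toℕ i + r)

  shift-shift : ∀ r r′ i → shift r (shift r′ i) ≡ shift (r′ + r) i
  shift-shift r r′ i = toℕ-injective (begin
    toℕ (shift r (shift r′ i))    ≡⟨ toℕ-shift r (shift r′ i) ⟩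
    (toℕ (shift r′ i) + r) % m    ≡⟨ cong (λ x → (x + r) % m) (toℕ-shift r′ i) ⟩
    ((toℕ i + r′) % m + r) % m    ≡⟨ [a%m+b]%m≡[a+b]%m (toℕ i + r′) r ⟩
    (toℕ i + r′ + r) % m          ≡⟨ cong (_% m) (+-assoc (toℕ i) r′ r) ⟩
    (toℕ i + (r′ + r)) % m        ≡⟨ toℕ-shift (r′ + r) i ⟨
    toℕ (shift (r′ + r) i)        ∎)

  shift-m : ∀ i → shift m i ≡ i
  shift-m i = toℕ-injective (begin
    toℕ (shift m i)    ≡⟨ toℕ-shift m i ⟩
    (toℕ i + m) % m    ≡⟨ [m+n]%n≡m%n (toℕ i) m ⟩
    toℕ i % m          ≡⟨ m<n⇒m%n≡m (toℕ<n i) ⟩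
    toℕ i              ∎)

  shift-zero : ∀ i → shift 0 i ≡ i
  shift-zero i = toℕ-injective (begin
    toℕ (shift 0 i)    ≡⟨ toℕ-shift 0 i ⟩
    (toℕ i + 0) % m    ≡⟨ cong (_% m) (+-identityʳ (toℕ i)) ⟩
    toℕ i % m          ≡⟨ m<n⇒m%n≡m (toℕ<n i) ⟩
    toℕ i              ∎)

  shift-shift-∸ : ∀ {r} → r ≤ m → ∀ i → shift r (shift (m ∸ r) i) ≡ i
  shift-shift-∸ {r} r≤m i = begin
    shift r (shift (m ∸ r) i)   ≡⟨ shift-shift r (m ∸ r) i ⟩
    shift (m ∸ r + r) i         ≡⟨ cong (λ x → shift x i) (m∸n+n≡m r≤m) ⟩
    shift m i                   ≡⟨ shift-m i ⟩
    i                           ∎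

  next-shift : ∀ r i → next (shift r i) ≡ shift r (next i)
  next-shift r i = begin
    shift 1 (shift r i)   ≡⟨ shift-shift 1 r i ⟩
    shift (r + 1) i       ≡⟨ cong (λ x → shift x i) (+-comm r 1) ⟩
    shift (1 + r) i       ≡⟨ shift-shift r 1 i ⟨
    shift r (shift 1 i)   ∎

  shift-cancel : ∀ {r r′} → r < m → r′ < m → ∀ i → shift r i ≡ shift r′ i → r ≡ r′
  shift-cancel {r} {r′} r<m r′<m i eq = begin
    r                                     ≡⟨ unshift r<m ⟨
    toℕ (shift (m ∸ toℕ i) (shift r i))   ≡⟨ cong (toℕ ∘ shift (m ∸ toℕ i)) eq ⟩
    toℕ (shift (m ∸ toℕ i) (shift r′ i))  ≡⟨ unshift r′<m ⟩
    r′                                    ∎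
    where
    unshift : ∀ {s} → s < m → toℕ (shift (m ∸ toℕ i) (shift s i)) ≡ s
    unshift {s} s<m = begin
      toℕ (shift (m ∸ toℕ i) (shift s i))   ≡⟨ cong toℕ (shift-shift (m ∸ toℕ i) s i) ⟩
      toℕ (shift (s + (m ∸ toℕ i)) i)       ≡⟨ toℕ-shift (s + (m ∸ toℕ i)) i ⟩
      (toℕ i + (s + (m ∸ toℕ i))) % m       ≡⟨ cong (_% m) (+-comm (toℕ i) _) ⟩
      (s + (m ∸ toℕ i) + toℕ i) % m         ≡⟨ cong (_% m) (+-assoc s (m ∸ toℕ i) (toℕ i)) ⟩
      (s + (m ∸ toℕ i + toℕ i)) % m         ≡⟨ cong (λ x → (s + x) % m) (m∸n+n≡m (<⇒≤ (toℕ<n i))) ⟩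
      (s + m) % m                           ≡⟨ [m+n]%n≡m%n s m ⟩
      s % m                                 ≡⟨ m<n⇒m%n≡m s<m ⟩
      s                                     ∎

  shift-no-fixpoint : ∀ {r} → 0 < r → r < m → ∀ i → shift r i ≢ i
  shift-no-fixpoint {r} 0<r r<m i eq =
    <⇒≢ 0<r (sym (shift-cancel r<m (<-trans 0<r r<m) i (trans eq (sym (shift-zero i)))))

  next-injective : ∀ {i j} → next i ≡ next j → i ≡ j
  next-injective {i} {j} eq = begin
    i                        ≡⟨ unnext i ⟨
    shift (m ∸ 1) (next i)   ≡⟨ cong (shift (m ∸ 1)) eq ⟩
    shift (m ∸ 1) (next j)   ≡⟨ unnext j ⟩
    j                        ∎
    where
    unnext : ∀ i → shift (m ∸ 1) (next i) ≡ i
    unnext i = begin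
      shift (m ∸ 1) (shift 1 i)   ≡⟨ shift-shift (m ∸ 1) 1 i ⟩
      shift (1 + (m ∸ 1)) i       ≡⟨ cong (λ x → shift x i) (m+[n∸m]≡n (>-nonZero⁻¹ m)) ⟩
      shift m i                   ≡⟨ shift-m i ⟩
      i                           ∎

  wrap-+ : ∀ a j → wrap (a + j) ≡ shift a (wrap j)
  wrap-+ a j = toℕ-injective (begin
    toℕ (wrap (a + j))      ≡⟨ toℕ-wrap (a + j) ⟩
    (a + j) % m             ≡⟨ cong (_% m) (+-comm a j) ⟩
    (j + a) % m             ≡⟨ [a%m+b]%m≡[a+b]%m j a ⟨
    (j % m + a) % m         ≡⟨ cong (λ x → (x + a) % m) (toℕ-wrap j) ⟨
    (toℕ (wrap j) + a) % m  ≡⟨ toℕ-shift a (wrap j) ⟨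
    toℕ (shift a (wrap j))  ∎)

  wrap-suc : ∀ j → wrap (suc j) ≡ next (wrap j)
  wrap-suc = wrap-+ 1

  window-injective : ∀ {K} → K ≤ m → ∀ c → Injective _≡_ _≡_ (λ (o : Fin K) → wrap (toℕ o + c))
  window-injective K≤m c {o} {o′} eq = toℕ-injective
    (shift-cancel (<-≤-trans (toℕ<n o) K≤m) (<-≤-trans (toℕ<n o′) K≤m) (wrap c)
      (trans (sym (wrap-+ (toℕ o) c)) (trans eq (wrap-+ (toℕ o′) c))))

  Budget : (Fin m → Pattern) → Set
  Budget B = ∀ {K} (f : Fin K → Fin m) → Injective _≡_ _≡_ f → ∑[ o < K ] size (B (f o)) ≤ 3

  record Admissible (B : Fin m → Pattern) : Set where
    field
      consistent : ∀ i → Consistent (B i)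
      linked     : ∀ i → B i ⇢ B (next i)
      budget     : Budget B

  record CyclicFill (B : Fin m → Pattern) (S : Fin m → State) : Set where
    field
      fits  : ∀ i → Fits (B i) (S i)
      links : ∀ i → S i ⟶ S (next i)

    valid : ∀ i → Valid (S i)
    valid = proj₂ ∘ fits

  rotate : ∀ {B S r} → r ≤ m → CyclicFill (B ∘ shift r) S → CyclicFill B (S ∘ shift (m ∸ r))
  rotate {B} {S} {r} r≤m fill = record
    { fits  = λ i → subst (λ j → Fits (B j) (S (shift (m ∸ r) i))) (shift-shift-∸ r≤m i)
                          (fits (shift (m ∸ r) i))
    ; links = λ i → subst (λ j → S (shift (m ∸ r) i) ⟶ S j) (next-shift (m ∸ r) i)
                          (links (shift (m ∸ r) i))
    }
    where open CyclicFill fill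

module Arcs (n : ℕ) where

  open Cyclic (suc n)

  unroll : Fin (suc n) → (Fin (suc n) → Pattern) → ℕ → Pattern
  unroll q B j = B (wrap (j + toℕ q))

  unroll-linked : ∀ {B} q → (∀ i → B i ⇢ B (next i)) → ∀ j → unroll q B j ⇢ unroll q B (suc j)
  unroll-linked {B} q linked j = subst (λ i → unroll q B j ⇢ B i) (sym (wrap-suc (j + toℕ q))) (linked _)

  unroll-budget : ∀ {B} q → Budget B → ∀ {K} → K ≤ suc n → ∀ j → ∑[ o < K ] size (unroll q B (toℕ o + j)) ≤ 3
  unroll-budget q budget K≤m j = budget (λ o → wrap (toℕ o + j + toℕ q)) λ {o} {o′} eq →
    window-injective K≤m (j + toℕ q)
      (trans (cong wrap (sym (+-assoc (toℕ o) j (toℕ q))))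
        (trans eq (cong wrap (+-assoc (toℕ o′) j (toℕ q)))))

  ArcFill : (ℕ → Pattern) → (ℕ → State) → Set
  ArcFill B s = (∀ j → 1 ≤ j → j ≤ n → Fits (B j) (s j)) × (∀ j → 1 ≤ j → j < n → s j ⟶ s (suc j))

  close-arc : ∀ {B q s} → 1 ≤ n → size (B q) ≡ 0 → ArcFill (unroll q B) s → ∃ (CyclicFill B)
  close-arc {B} {q} {s} 1≤n free (arc-fits , arc-links) =
    S ∘ shift (suc n ∸ toℕ q) , rotate (<⇒≤ (toℕ<n q)) (record { fits = fits ; links = links })
    where
    end : ∀ {j} → 1 ≤ j → j ≤ n → Σ State Valid
    end {j} 1≤j j≤n = s j , proj₂ (arc-fits j 1≤j j≤n)

    closing : Σ State Valid
    closing = bridged (end 1≤n ≤-refl) (end ≤-refl 1≤n)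

    S : Fin (suc n) → State
    S zero = proj₁ closing
    S (suc i) = s (suc (toℕ i))

    S-toℕ : ∀ i → toℕ i ≢ 0 → S i ≡ s (toℕ i)
    S-toℕ zero 0≢0 = ⊥-elim (0≢0 refl)
    S-toℕ (suc i) _ = refl

    fits : ∀ i → Fits (unroll q B (toℕ i)) (S i)
    fits zero = size≡0⇒matches _ (subst (λ i → size (B i) ≡ 0) (sym (wrap-toℕ q)) free) , proj₂ closing
    fits (suc i) = arc-fits (suc (toℕ i)) (s≤s z≤n) (toℕ<n i)

    toℕ-next : ∀ i → toℕ i < n → toℕ (next i) ≡ suc (toℕ i)
    toℕ-next i i<n = trans (toℕ-shift 1 i)
      (trans (m<n⇒m%n≡m (s≤s (subst (_≤ n) (sym (+-comm (toℕ i) 1)) i<n))) (+-comm (toℕ i) 1))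

    next-last : ∀ i → toℕ i ≡ n → next i ≡ zero
    next-last i i≡n = toℕ-injective (trans (toℕ-shift 1 i) (trans (cong (λ x → (x + 1) % suc n) i≡n)
      (trans (cong (_% suc n) (+-comm n 1)) (n%n≡0 (suc n)))))

    S-next : ∀ i → toℕ i < n → S (next i) ≡ s (suc (toℕ i))
    S-next i i<n =
      trans (S-toℕ (next i) λ eq → 0≢1+n (trans (sym eq) (toℕ-next i i<n))) (cong s (toℕ-next i i<n))

    links : ∀ i → S i ⟶ S (next i)
    links zero = subst (proj₁ closing ⟶_) (sym (S-next zero 1≤n)) (bridged-to _ _)
    links (suc i) = link (suc (toℕ i) ≟ℕ n)
      where
      link : Dec (suc (toℕ i) ≡ n) → s (suc (toℕ i)) ⟶ S (next (suc i))
      link (yes i≡n) = subst₂ _⟶_ (cong s (sym i≡n)) (cong S (sym (next-last (suc i) i≡n))) (bridged-from _ _)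
      link (no i≢n) =
        subst (s (suc (toℕ i)) ⟶_) (sym (S-next (suc i) i<n)) (arc-links (suc (toℕ i)) (s≤s z≤n) i<n)
        where
        i<n : suc (toℕ i) < n
        i<n = ≤∧≢⇒< (toℕ<n i) i≢n

module _ where

  open Cyclic 3

  triangle-fill : ∀ B → Admissible B → (∀ i → size (B i) ≢ 0) → ∃ (CyclicFill B)
  triangle-fill B adm constrained = fill (cyclicFill₃ (B 0F) (B 1F) (B 2F) three-columns
    (constrained 0F) (constrained 1F) (constrained 2F)
    (consistent 0F) (consistent 1F) (consistent 2F) (linked 0F) (linked 1F) (linked 2F))
    where
    open Admissible adm
    three-columns : size (B 0F) + (size (B 1F) + size (B 2F)) ≤ 3
    three-columns =
      subst (λ x → size (B 0F) + (size (B 1F) + x) ≤ 3) (+-identityʳ (size (B 2F))) (budget id id)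
    fill : CyclicFill₃ (B 0F) (B 1F) (B 2F) → ∃ (CyclicFill B)
    fill (t₀ , f₀ , t₂ , f₂ , l₂₀ , t₁ , f₁ , l₀₁ , l₁₂) = S , record { fits = fits ; links = links }
      where
      S : Fin 3 → State
      S 0F = t₀
      S 1F = t₁
      S 2F = t₂
      fits : ∀ i → Fits (B i) (S i)
      fits 0F = f₀
      fits 1F = f₁
      fits 2F = f₂
      links : ∀ i → S i ⟶ S (next i)
      links 0F = l₀₁
      links 1F = l₁₂
      links 2F = l₂₀

arc-fill : ∀ n → 2 ≤ n → ∀ {B} q → Cyclic.Admissible (suc n) B → ∃ (Arcs.ArcFill n (Arcs.unroll n q B))
arc-fill 1 (s≤s ()) _ _
arc-fill 2 _ {B} q adm = arc (fill₃ (B′ 1) (B′ 2) (B′ 3) three-columns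
  (consistent _) (consistent _) (consistent _) (unroll-linked {B} q linked 1) (unroll-linked {B} q linked 2))
  where
  open Arcs 2
  open Cyclic.Admissible adm
  B′ : ℕ → Pattern
  B′ = unroll q B
  three-columns : size (B′ 1) + (size (B′ 2) + size (B′ 3)) ≤ 3
  three-columns = subst (λ x → size (B′ 1) + (size (B′ 2) + x) ≤ 3) (+-identityʳ (size (B′ 3)))
    (unroll-budget {B} q budget ≤-refl 1)
  arc : Fill₃ (B′ 1) (B′ 2) (B′ 3) → ∃ (ArcFill B′)
  arc (t₀ , f₀ , t₁ , f₁ , l₀₁ , _) = s , fits , links
    where
    s : ℕ → State
    s 1 = t₀
    s _ = t₁
    fits : ∀ j → 1 ≤ j → j ≤ 2 → Fits (B′ j) (s j)
    fits 1 _ _ = f₀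
    fits 2 _ _ = f₁
    fits (suc (suc (suc _))) _ (s≤s (s≤s ()))
    links : ∀ j → 1 ≤ j → j < 2 → s j ⟶ s (suc j)
    links 1 _ _ = l₀₁
    links (suc (suc _)) _ (s≤s (s≤s ()))
arc-fill n@(suc (suc (suc _))) _ {B} q adm =
  let s , fill = path-fill (unroll q B) (consistent ∘ _) (unroll-linked {B} q linked)
                           (unroll-budget {B} q budget 4≤m)
  in s , (λ j _ _ → PathFill.fits fill j) , (λ j _ _ → PathFill.links fill j)
  where
  open Arcs n
  open Cyclic.Admissible adm
  4≤m : 4 ≤ suc n
  4≤m = s≤s (s≤s (s≤s (s≤s z≤n)))

constrained-cycle-fill : ∀ n → 2 ≤ n → ∀ B → Cyclic.Admissible (suc n) B → (∀ i → size (B i) ≢ 0) →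
                         ∃ (Cyclic.CyclicFill (suc n) B)
constrained-cycle-fill 1 (s≤s ()) _ _ _
constrained-cycle-fill 2 _ B adm constrained = triangle-fill B adm constrained
constrained-cycle-fill n@(suc (suc (suc _))) _ B adm constrained =
  ⊥-elim (<-irrefl refl
    (≤-trans (∑-nonzero-≥ (constrained ∘ window)) (budget window (window-injective 4≤m 0))))
  where
  open Cyclic (suc n)
  open Admissible adm
  4≤m : 4 ≤ suc n
  4≤m = s≤s (s≤s (s≤s (s≤s z≤n)))
  window : Fin 4 → Fin (suc n)
  window o = wrap (toℕ o + 0)

cyclic-fill : ∀ n → 2 ≤ n → ∀ B → Cyclic.Admissible (suc n) B → ∃ (Cyclic.CyclicFill (suc n) B)
cyclic-fill n 2≤n B adm with any? (λ q → size (B q) ≟ℕ 0)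
... | yes (q , free) = Arcs.close-arc n (≤-trans (s≤s z≤n) 2≤n) free (proj₂ (arc-fill n 2≤n q adm))
... | no none = constrained-cycle-fill n 2≤n B adm λ q free → none (q , free)

-- The prism C_m □ K₂

module Prism (n : ℕ) (2≤n : 2 ≤ n) where

  m : ℕ
  m = suc n

  open Cyclic m

  Prism : Graph
  Prism = Cycle m □ K2

  Vertex Slot : Set
  Vertex = Fin m × Fin 2
  Slot = Fin m × Component

  Endpoint : Edge Prism → Vertex → Set
  Endpoint e v = src e ≡ v ⊎ tgt e ≡ v

  adjacent⇒≡next : ∀ i j → toℕ j ≡ (toℕ i + 1) % m → j ≡ next i
  adjacent⇒≡next i j f = toℕ-injective (trans f (sym (toℕ-shift 1 i)))

  next-irreflexive : ∀ i → next i ≢ i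
  next-irreflexive = shift-no-fixpoint (s≤s z≤n) (s≤s (≤-trans (s≤s z≤n) 2≤n))

  next-next-irreflexive : ∀ i → next (next i) ≢ i
  next-next-irreflexive i eq = shift-no-fixpoint (s≤s z≤n) (s≤s 2≤n) i (trans (sym (shift-shift 1 1 i)) eq)

  ¬both-ways : ∀ i j → toℕ j ≡ (toℕ i + 1) % m → toℕ i ≡ (toℕ j + 1) % m → ⊥
  ¬both-ways i j f f′ =
    next-next-irreflexive i (trans (cong next (sym (adjacent⇒≡next i j f))) (sym (adjacent⇒≡next j i f′)))

  layer-cases : ∀ {b b′ : Fin 2} → b ≢ b′ → ∀ c → c ≡ b ⊎ c ≡ b′
  layer-cases {zero} {zero} b≢b′ _ = ⊥-elim (b≢b′ refl)
  layer-cases {zero} {suc zero} _ zero = inj₁ refl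
  layer-cases {zero} {suc zero} _ (suc zero) = inj₂ refl
  layer-cases {suc zero} {zero} _ zero = inj₂ refl
  layer-cases {suc zero} {zero} _ (suc zero) = inj₁ refl
  layer-cases {suc zero} {suc zero} b≢b′ _ = ⊥-elim (b≢b′ refl)

  -- the rung of column i, or the rail edge from column i to column next i
  slot : Edge Prism → Slot
  slot (((i , _) , _) , inj₁ _) = i , rung
  slot (((i , b) , _) , inj₂ (inj₁ _ , _)) = i , rail b
  slot ((_ , (j , b)) , inj₂ (inj₂ _ , _)) = j , rail b

  data Ends : Slot → Vertex → Set where
    rung-end  : ∀ {i b} → Ends (i , rung) (i , b)
    rail-tail : ∀ {i b} → Ends (i , rail b) (i , b)
    rail-head : ∀ {i j b} → j ≡ next i → Ends (i , rail b) (j , b)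

  endpoint⇒ends : ∀ e {v} → Endpoint e v → Ends (slot e) v
  endpoint⇒ends (_ , inj₁ (refl , _)) (inj₁ refl) = rung-end
  endpoint⇒ends (_ , inj₁ (refl , _)) (inj₂ refl) = rung-end
  endpoint⇒ends (_ , inj₂ (inj₁ _ , refl)) (inj₁ refl) = rail-tail
  endpoint⇒ends (((i , _) , (j , _)) , inj₂ (inj₁ f , refl)) (inj₂ refl) = rail-head (adjacent⇒≡next i j f)
  endpoint⇒ends (((i , _) , (j , _)) , inj₂ (inj₂ f , refl)) (inj₁ refl) = rail-head (adjacent⇒≡next j i f)
  endpoint⇒ends (_ , inj₂ (inj₂ _ , refl)) (inj₂ refl) = rail-tail

  ends⇒endpoint : ∀ e {v} → Ends (slot e) v → Endpoint e v
  ends⇒endpoint (_ , inj₁ (refl , b≢b′)) (rung-end {b = c}) with layer-cases b≢b′ c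
  ... | inj₁ refl = inj₁ refl
  ... | inj₂ refl = inj₂ refl
  ends⇒endpoint (_ , inj₂ (inj₁ _ , refl)) rail-tail = inj₁ refl
  ends⇒endpoint (((i , _) , (j , _)) , inj₂ (inj₁ f , refl)) (rail-head refl) =
    inj₂ (cong (_, _) (adjacent⇒≡next i j f))
  ends⇒endpoint (((i , _) , (j , _)) , inj₂ (inj₂ f , refl)) (rail-head refl) =
    inj₁ (cong (_, _) (adjacent⇒≡next j i f))
  ends⇒endpoint (_ , inj₂ (inj₂ _ , refl)) rail-tail = inj₂ refl

  no-loop : ∀ (e : Edge Prism) → src e ≢ tgt e
  no-loop (_ , inj₁ (_ , b≢b′)) refl = b≢b′ refl
  no-loop (((i , _) , _) , inj₂ (inj₁ f , refl)) refl = next-irreflexive i (sym (adjacent⇒≡next i i f))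
  no-loop (((i , _) , _) , inj₂ (inj₂ f , refl)) refl = next-irreflexive i (sym (adjacent⇒≡next i i f))

  slot-injective : ∀ e e′ → slot e ≡ slot e′ → SameEdge e e′
  slot-injective e e′ eq = same (transfer (inj₁ refl)) (transfer (inj₂ refl))
    where
    transfer : ∀ {v} → Endpoint e v → Endpoint e′ v
    transfer p = ends⇒endpoint e′ (subst (λ σ → Ends σ _) eq (endpoint⇒ends e p))
    same : Endpoint e′ (src e) → Endpoint e′ (tgt e) → SameEdge e e′
    same (inj₁ s≡s) (inj₁ s≡t) = ⊥-elim (no-loop e (trans (sym s≡s) s≡t))
    same (inj₁ s≡s) (inj₂ t≡t) = inj₁ (sym s≡s , sym t≡t)
    same (inj₂ t≡s) (inj₁ s≡t) = inj₂ (sym t≡s , sym s≡t)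
    same (inj₂ t≡s) (inj₂ t≡t) = ⊥-elim (no-loop e (trans (sym t≡s) t≡t))

  slot-irrelevant : ∀ {u v} (a a′ : Adj Prism u v) → slot ((u , v) , a) ≡ slot ((u , v) , a′)
  slot-irrelevant (inj₁ _) (inj₁ _) = refl
  slot-irrelevant (inj₁ (_ , b≢b′)) (inj₂ (_ , b≡b′)) = ⊥-elim (b≢b′ b≡b′)
  slot-irrelevant (inj₂ (_ , b≡b′)) (inj₁ (_ , b≢b′)) = ⊥-elim (b≢b′ b≡b′)
  slot-irrelevant (inj₂ (inj₁ _ , _)) (inj₂ (inj₁ _ , _)) = refl
  slot-irrelevant {i , _} {j , _} (inj₂ (inj₁ f , _)) (inj₂ (inj₂ f′ , _)) = ⊥-elim (¬both-ways i j f f′)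
  slot-irrelevant {i , _} {j , _} (inj₂ (inj₂ f , _)) (inj₂ (inj₁ f′ , _)) = ⊥-elim (¬both-ways i j f′ f)
  slot-irrelevant (inj₂ (inj₂ _ , _)) (inj₂ (inj₂ _ , _)) = refl

  slot-flip : ∀ {u v} (a : Adj Prism u v) (a′ : Adj Prism v u) → slot ((v , u) , a′) ≡ slot ((u , v) , a)
  slot-flip (inj₁ (refl , _)) (inj₁ _) = refl
  slot-flip (inj₁ (_ , b≢b′)) (inj₂ (_ , b′≡b)) = ⊥-elim (b≢b′ (sym b′≡b))
  slot-flip (inj₂ (_ , b≡b′)) (inj₁ (_ , b′≢b)) = ⊥-elim (b′≢b (sym b≡b′))
  slot-flip (inj₂ (inj₁ _ , refl)) (inj₂ (inj₂ _ , _)) = refl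
  slot-flip {i , _} {j , _} (inj₂ (inj₁ f , _)) (inj₂ (inj₁ f′ , _)) = ⊥-elim (¬both-ways i j f f′)
  slot-flip (inj₂ (inj₂ _ , refl)) (inj₂ (inj₁ _ , _)) = refl
  slot-flip {i , _} {j , _} (inj₂ (inj₂ f , _)) (inj₂ (inj₂ f′ , _)) = ⊥-elim (¬both-ways i j f′ f)

  slot-cong : ∀ e e′ → SameEdge e e′ → slot e ≡ slot e′
  slot-cong (_ , a) (_ , a′) (inj₁ (refl , refl)) = slot-irrelevant a a′
  slot-cong (_ , a) (_ , a′) (inj₂ (refl , refl)) = sym (slot-flip a a′)

  colourAt : (Fin m → State) → Slot → Colour
  colourAt S (i , q) = S i at q

  colouring : (Fin m → State) → EdgeColoring Prism 4
  colouring S = record { col = colourAt S ∘ slot ; wellDef = λ e e′ → cong (colourAt S) ∘ slot-cong e e′ }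

  distinct-at-vertex : ∀ {S} → (∀ i → Valid (S i)) → (∀ i → S i ⟶ S (next i)) →
                       ∀ {σ σ′ v} → Ends σ v → Ends σ′ v → σ ≢ σ′ → colourAt S σ ≢ colourAt S σ′
  distinct-at-vertex valid links rung-end rung-end σ≢σ′ = ⊥-elim (σ≢σ′ refl)
  distinct-at-vertex valid links rung-end (rail-tail {i} {b}) _ eq = valid i b (sym eq)
  distinct-at-vertex valid links rung-end (rail-head {i} {b = b} refl) _ eq = proj₁ (links i b) (sym eq)
  distinct-at-vertex valid links (rail-tail {i} {b}) rung-end _ = valid i b
  distinct-at-vertex valid links rail-tail rail-tail σ≢σ′ = ⊥-elim (σ≢σ′ refl)
  distinct-at-vertex valid links rail-tail (rail-head {i} {b = b} refl) _ eq = proj₂ (links i b) (sym eq)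
  distinct-at-vertex valid links (rail-head {i} {b = b} refl) rung-end _ = proj₁ (links i b)
  distinct-at-vertex valid links (rail-head {i} {b = b} refl) rail-tail _ = proj₂ (links i b)
  distinct-at-vertex valid links (rail-head e) (rail-head e′) σ≢σ′ =
    ⊥-elim (σ≢σ′ (cong (_, _) (next-injective (trans (sym e) e′))))

  shared-endpoint : ∀ e e′ → AdjacentEdges e e′ → ∃[ v ] Endpoint e v × Endpoint e′ v
  shared-endpoint e e′ (_ , inj₁ p) = src e , inj₁ refl , inj₁ (sym p)
  shared-endpoint e e′ (_ , inj₂ (inj₁ p)) = src e , inj₁ refl , inj₂ (sym p)
  shared-endpoint e e′ (_ , inj₂ (inj₂ (inj₁ p))) = tgt e , inj₂ refl , inj₁ (sym p)
  shared-endpoint e e′ (_ , inj₂ (inj₂ (inj₂ p))) = tgt e , inj₂ refl , inj₂ (sym p)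

  endpoints⇒adjacent : ∀ e e′ {v} → ¬ SameEdge e e′ → Endpoint e v → Endpoint e′ v → AdjacentEdges e e′
  endpoints⇒adjacent _ _ ¬same (inj₁ p) (inj₁ p′) = ¬same , inj₁ (trans p (sym p′))
  endpoints⇒adjacent _ _ ¬same (inj₁ p) (inj₂ p′) = ¬same , inj₂ (inj₁ (trans p (sym p′)))
  endpoints⇒adjacent _ _ ¬same (inj₂ p) (inj₁ p′) = ¬same , inj₂ (inj₂ (inj₁ (trans p (sym p′))))
  endpoints⇒adjacent _ _ ¬same (inj₂ p) (inj₂ p′) = ¬same , inj₂ (inj₂ (inj₂ (trans p (sym p′))))

  colouring-proper : ∀ {B S} → CyclicFill B S → IsProper (colouring S)
  colouring-proper fill e e′ adj =
    let v , p , p′ = shared-endpoint e e′ adj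
    in distinct-at-vertex (CyclicFill.valid fill) (CyclicFill.links fill)
         (endpoint⇒ends e p) (endpoint⇒ends e′ p′) (proj₁ adj ∘ slot-injective e e′)

  Precoloured : Set
  Precoloured = Edge Prism × Colour

  Compatible : Precoloured → Precoloured → Set
  Compatible (e , c) (e′ , c′) = ¬ SameEdge e e′ × (AdjacentEdges e e′ → c ≢ c′)

  prescribed : List Precoloured → Fin m → Pattern
  prescribed [] i = blank
  prescribed ((e , c) ∷ xs) i with proj₁ (slot e) ≟ i
  ... | yes _ = prescribed xs i [ proj₂ (slot e) ]≔ just c
  ... | no _ = prescribed xs i

  prescribed-at : ∀ xs {i q c} → prescribed xs i at q ≡ just c →
                  ∃[ x ] x ∈ xs × slot (proj₁ x) ≡ (i , q) × proj₂ x ≡ c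
  prescribed-at [] {q = q} eq with () ← trans (sym (blank-at q)) eq
  prescribed-at ((e , c′) ∷ xs) {i} {q} eq with proj₁ (slot e) ≟ i
  ... | no _ = let x , x∈ , p = prescribed-at xs eq in x , there x∈ , p
  ... | yes refl with proj₂ (slot e) ≟ᶜ q
  ...   | yes refl =
          (e , c′) , here refl , refl , just-injective (trans (sym (at∘≔ (prescribed xs i) q (just c′))) eq)
  ...   | no q′≢q = let x , x∈ , p = prescribed-at xs (trans (sym (at∘≔′ _ _ q′≢q)) eq) in x , there x∈ , p

  prescribed-at-slot : ∀ {xs} → AllPairs Compatible xs → ∀ {e c} → (e , c) ∈ xs →
                       prescribed xs (proj₁ (slot e)) at proj₂ (slot e) ≡ just c
  prescribed-at-slot {(e , c) ∷ xs} (_ ∷ _) (here refl) with proj₁ (slot e) ≟ proj₁ (slot e)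
  ... | yes _ = at∘≔ (prescribed xs (proj₁ (slot e))) (proj₂ (slot e)) (just c)
  ... | no ≢ = ⊥-elim (≢ refl)
  prescribed-at-slot {(e′ , c′) ∷ xs} (ok ∷ oks) {e} (there x∈) with proj₁ (slot e′) ≟ proj₁ (slot e)
  ... | no _ = prescribed-at-slot oks x∈
  ... | yes same-column with proj₂ (slot e′) ≟ᶜ proj₂ (slot e)
  ...   | yes same-component =
          ⊥-elim (proj₁ (All.lookup ok x∈) (slot-injective e′ e (cong₂ _,_ same-column same-component)))
  ...   | no ≢ = trans (at∘≔′ _ _ ≢) (prescribed-at-slot oks x∈)

  apart-intro : ∀ x y → (∀ {a b} → x ≡ just a → y ≡ just b → a ≢ b) → Apart x y
  apart-intro (just a) (just b) h = h refl refl
  apart-intro (just _) nothing _ = tt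
  apart-intro nothing _ _ = tt

  prescribed-apart : ∀ {xs} → AllPairs Compatible xs → ∀ {σ σ′ v} → Ends σ v → Ends σ′ v → σ ≢ σ′ →
                     Apart (prescribed xs (proj₁ σ) at proj₂ σ) (prescribed xs (proj₁ σ′) at proj₂ σ′)
  prescribed-apart {xs} ok {σ} {σ′} {v} end end′ σ≢σ′ = apart-intro _ _ λ eq eq′ →
    let x , x∈ , x-slot , x-colour = prescribed-at xs eq
        y , y∈ , y-slot , y-colour = prescribed-at xs eq′
    in λ a≡b → colours-apart x∈ y∈ x-slot y-slot (trans x-colour (trans a≡b (sym y-colour)))
    where
    endpoint : ∀ e {τ} → slot e ≡ τ → Ends τ v → Endpoint e v
    endpoint e refl = ends⇒endpoint e
    colours-apart : ∀ {x y} → x ∈ xs → y ∈ xs → slot (proj₁ x) ≡ σ → slot (proj₁ y) ≡ σ′ → proj₂ x ≢ proj₂ y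
    colours-apart {e , _} {e′ , _} x∈ y∈ x-slot y-slot with allPairs-related ok x∈ y∈
    ... | inj₁ refl = ⊥-elim (σ≢σ′ (trans (sym x-slot) y-slot))
    ... | inj₂ (inj₁ (¬same , proper)) =
      proper (endpoints⇒adjacent e e′ ¬same (endpoint e x-slot end) (endpoint e′ y-slot end′))
    ... | inj₂ (inj₂ (¬same , proper)) =
      proper (endpoints⇒adjacent e′ e ¬same (endpoint e′ y-slot end′) (endpoint e x-slot end)) ∘ sym

  prescribed-consistent : ∀ {xs} → AllPairs Compatible xs → ∀ i → Consistent (prescribed xs i)
  prescribed-consistent ok i b = prescribed-apart ok (rail-tail {i} {b}) rung-end λ ()

  prescribed-linked : ∀ {xs} → AllPairs Compatible xs → ∀ i → prescribed xs i ⇢ prescribed xs (next i)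
  prescribed-linked ok i b =
    prescribed-apart ok (rail-head {i} {b = b} refl) rung-end (λ ()) ,
    prescribed-apart ok (rail-head {i} {b = b} refl) rail-tail (next-irreflexive i ∘ sym ∘ cong proj₁)

  hits : Edge Prism → Fin m → ℕ
  hits e i = if does (proj₁ (slot e) ≟ i) then 1 else 0

  load : List Precoloured → Fin m → ℕ
  load [] i = 0
  load ((e , _) ∷ xs) i = hits e i + load xs i

  size-prescribed≤load : ∀ xs i → size (prescribed xs i) ≤ load xs i
  size-prescribed≤load [] i = z≤n
  size-prescribed≤load ((e , c) ∷ xs) i with proj₁ (slot e) ≟ i
  ... | yes _ = ≤-trans (size∘≔ (prescribed xs i) (proj₂ (slot e)) c) (s≤s (size-prescribed≤load xs i))
  ... | no _ = size-prescribed≤load xs i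

  ∑-load-injective : ∀ xs {K} (f : Fin K → Fin m) → Injective _≡_ _≡_ f → ∑[ o < K ] load xs (f o) ≤ length xs
  ∑-load-injective [] {K} f inj = ≤-reflexive (sum-replicate-zero K)
  ∑-load-injective ((e , c) ∷ xs) {K} f inj = begin
    ∑[ o < K ] (hits e (f o) + load xs (f o))          ≡⟨ ∑-distrib-+ (hits e ∘ f) (load xs ∘ f) ⟩
    ∑[ o < K ] hits e (f o) + ∑[ o < K ] load xs (f o)
      ≤⟨ +-mono-≤ (∑-indicator-injective f inj (proj₁ (slot e))) (∑-load-injective xs f inj) ⟩
    1 + length xs                                       ∎
    where open ≤-Reasoning

  prescribed-admissible : ∀ {xs} → AllPairs Compatible xs → length xs ≤ 3 → Admissible (prescribed xs)
  prescribed-admissible {xs} ok len≤3 = record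
    { consistent = prescribed-consistent ok
    ; linked     = prescribed-linked ok
    ; budget     = λ f inj → ≤-trans (∑-mono-≤ (size-prescribed≤load xs ∘ f))
                                     (≤-trans (∑-load-injective xs f inj) len≤3)
    }

  colouring-extends : ∀ {xs S} → AllPairs Compatible xs → CyclicFill (prescribed xs) S →
                      ∀ {e c} → (e , c) ∈ xs → col (colouring S) e ≡ c
  colouring-extends ok fill {e} e∈ =
    agrees (prescribed-at-slot ok e∈) (proj₁ (CyclicFill.fits fill (proj₁ (slot e))) (proj₂ (slot e)))
    where
    agrees : ∀ {x c y} → x ≡ just c → AllJust (_≡ y) x → y ≡ c
    agrees refl (just c≡y) = sym c≡y

  extension : ∀ xs → AllPairs Compatible xs → length xs ≤ 3 →
              Σ[ f ∈ EdgeColoring Prism 4 ] IsProper f × (∀ {e c} → (e , c) ∈ xs → col f e ≡ c)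
  extension xs ok len≤3 =
    let S , fill = cyclic-fill n 2≤n (prescribed xs) (prescribed-admissible ok len≤3)
    in colouring S , colouring-proper fill , colouring-extends ok fill

  precoloured : Precoloring3 Prism 4 → List Precoloured
  precoloured φ = (e₁ φ , c₁ φ) ∷ (e₂ φ , c₂ φ) ∷ (e₃ φ , c₃ φ) ∷ []

  precoloured-compatible : ∀ φ → AllPairs Compatible (precoloured φ)
  precoloured-compatible φ =
    ((dist₁₂ φ , prop₁₂ φ) ∷ (dist₁₃ φ , prop₁₃ φ) ∷ []) ∷ ((dist₂₃ φ , prop₂₃ φ) ∷ []) ∷ [] ∷ []

proposition4p4 : (n : ℕ) → n ≥ 1 →
    (φ : Precoloring3 (Cycle (suc (2 * n)) □ K2) 4) →
    Σ (EdgeColoring (Cycle (suc (2 * n)) □ K2) 4) λ f → IsProper f × Extends f φ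
proposition4p4 n n≥1 φ =
  let f , proper , extends = extension (precoloured φ) (precoloured-compatible φ) ≤-refl
  in f , proper , extends (here refl) , extends (there (here refl)) , extends (there (there (here refl)))
  where open Prism (2 * n) (*-monoʳ-≤ 2 n≥1)
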